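{- Let $s$ be a positive integer. For all positive integers $k$ and $n$, $$c_k^{(s)}\big(n\,(k^*)^s\big)=(k^*)^s\, c_{\overline{k}}^{(s)}(n).$$
   Context: For a positive integer $k$, $\overline{k}$ (the core of $k$) is the largest square-free divisor of $k$, and $k^*=k/\overline{k}$. For positive integers $a,b$, $(a,b)_s$ denotes the largest $d^s$ ($d\in\mathbb{N}$) with $d^s\mid a$ and $d^s\mid b$. The Cohen–Ramanujan sum is $c_k^{(s)}(n)=\sum_{h=1,\ (h,k^s)_s=1}^{k^s} e^{2\pi i n h/k^s}$. -}

module Defs where

open import Data.Nat using (ℕ; zero; suc; _*_; _^_; _≤_; _≟_)
open import Data.Nat.Divisibility using (_∣_; _∣?_)
open import Data.Integer using (+_)
open import Data.Rational using (ℚ; 0ℚ; _/_)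
open import Data.List using (List; []; _∷_; foldr; map; upTo)
open import Data.Bool using (if_then_else_)
open import Relation.Nullary.Decidable using (does; _×-dec_)
open import Data.Product using (_×_)
open import Relation.Binary.PropositionalEquality using (_≡_)
open import Algebra.Bundles using (CommutativeRing)

SquareFree : ℕ → Set
SquareFree m = ∀ d → d * d ∣ m → d ≡ 1

IsCore : ℕ → ℕ → Set
IsCore k kbar = kbar ∣ k × SquareFree kbar × (∀ d → d ∣ k → SquareFree d → d ≤ kbar)

bestRoot : ℕ → ℕ → ℕ → ℕ → ℕ
bestRoot s a b zero = 1
bestRoot s a b (suc d) =
  if does ((suc d ^ s ∣? a) ×-dec (suc d ^ s ∣? b)) then suc d else bestRoot s a b d

-- (a , b)_s : the largest d^s dividing both a and b (for b ≥ 1, s ≥ 1,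
-- any such d satisfies d ≤ b, so searching d ∈ [1..b] suffices).
gcdₛ : ℕ → ℕ → ℕ → ℕ
gcdₛ s a b = bestRoot s a b b ^ s

-- the rational a / m (junk value 0 when m = 0)
frac : ℕ → ℕ → ℚ
frac a zero = 0ℚ
frac a (suc m) = (+ a) / suc m

module _ {c ℓ} (R : CommutativeRing c ℓ) where
  open CommutativeRing R using (Carrier; _+_; 0#; 1#)

  sumR : List Carrier → Carrier
  sumR = foldr _+_ 0#

  natR : ℕ → Carrier
  natR zero = 0#
  natR (suc n) = 1# + natR n

  -- Cohen–Ramanujan sum c_k^{(s)}(n) = Σ_{1 ≤ h ≤ k^s, (h,k^s)_s = 1} e(n h / k^s),
  -- where e : ℚ → R plays the role of x ↦ exp(2π i x).
  cohenRamanujan : (ℚ → Carrier) → ℕ → ℕ → ℕ → Carrier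
  cohenRamanujan e s k n =
    sumR (map (λ i → let h = suc i in
                 if does (gcdₛ s h (k ^ s) ≟ 1)
                 then e (frac (n * h) (k ^ s)) else 0#)
              (upTo (k ^ s)))

{-# OPTIONS --safe #-}
module Submission where

-- Write k^s = A * B with A = (k*)^s and B = kbar^s. Every prime dividing k divides its core
-- kbar, so if d ≥ 2 has d^s dividing both h and k^s, then for any prime p ∣ d the power p^s
-- divides both h and kbar^s: the conditions (h, k^s)_s = 1 and (h, kbar^s)_s = 1 coincide. As moreover
-- n A h / (A B) = n h / B, the h-th summand of c_k(n A) equals the h-th summand of c_kbar(n),
-- and this summand is B-periodic in h; the sum over 1 ≤ h ≤ A B is A copies of the sum over
-- 1 ≤ h ≤ B.

open import Defs
open import Data.Nat using (ℕ; _*_; _^_; _≤_)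
open import Data.Rational using (ℚ; 1ℚ; toℚᵘ; fromℚᵘ) renaming (_+_ to _+ℚ_)
open import Algebra.Bundles using (CommutativeRing)
open import Data.Nat.Base using (zero; suc; _+_; _<_; z≤n; s≤s; NonZero; >-nonZero; nonTrivial⇒n>1)
open import Data.Nat.Properties using (_≟_; ≤-refl; ≤-trans; <⇒≱; >⇒≢; m≤n⇒m≤1+n; m≤n⇒m<n∨m≡n; *-comm; m≤m*n; m<m*n; m*n≢0⇒m≢0; m*n≢0⇒n≢0; m^n≢0; m^n>0; +-assoc; +-suc; *-distribˡ-+; *-mono-≤; m^n≡1⇒n≡0∨m≡1; ^-zeroˡ)
open import Data.Nat.Divisibility
open import Data.Nat.Coprimality using (Coprime; coprime-divisor)
open import Data.Nat.Primality using (Prime; euclidsLemma; prime⇒irreducible; prime⇒nonZero; prime⇒nonTrivial; ¬prime[1])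
open import Data.Nat.Primality.Factorisation using (factorise)
open import Data.Nat.ListAction using (product)
open import Data.Nat.Tactic.RingSolver using (solve-∀)
open import Data.List using ([]; _∷_; applyUpTo)
open import Data.List.Properties using (map-upTo)
open import Data.List.Relation.Unary.All using (_∷_)
open import Data.Bool using (Bool; true; false; if_then_else_)
open import Data.Product using (∃-syntax; _×_; _,_)
open import Data.Sum using (inj₁; inj₂; [_,_]′)
open import Data.Empty using (⊥; ⊥-elim)
open import Data.Integer as ℤ using (ℤ; +_)
open import Data.Integer.Properties using (pos-+; pos-*)
import Data.Integer.Tactic.RingSolver as ℤ-Solver
open import Data.Rational.Properties using (toℚᵘ-injective; toℚᵘ-fromℚᵘ; toℚᵘ-homo-+; fromℚᵘ-cong)
open import Data.Rational.Unnormalised as ℚᵘ using (mkℚᵘ; *≡*)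
import Data.Rational.Unnormalised.Properties as ℚᵘ
open import Function using (_∘_; _⇔_; mk⇔)
open import Function.Properties.Equivalence using () renaming (trans to ⇔-trans; sym to ⇔-sym)
open import Relation.Nullary using (¬_; yes; no; does; contradiction)
open import Relation.Nullary.Decidable using (does-⇔)
open import Relation.Binary.PropositionalEquality using (_≡_; refl; sym; trans; cong; cong₂; subst; module ≡-Reasoning)

^-distribʳ-* : ∀ m n s → (m * n) ^ s ≡ m ^ s * n ^ s
^-distribʳ-* m n zero = refl
^-distribʳ-* m n (suc s) = trans (cong (m * n *_) (^-distribʳ-* m n s)) (interchange m n (m ^ s) (n ^ s))
  where
  interchange : ∀ a b c d → a * b * (c * d) ≡ a * c * (b * d)
  interchange = solve-∀

^-monoˡ-∣ : ∀ {m n} s → m ∣ n → m ^ s ∣ n ^ s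
^-monoˡ-∣ zero m∣n = ∣-refl
^-monoˡ-∣ (suc s) m∣n = *-pres-∣ m∣n (^-monoˡ-∣ s m∣n)

m≤m^n : ∀ m n → 1 ≤ m → 1 ≤ n → m ≤ m ^ n
m≤m^n m (suc n) 1≤m _ = m≤m*n m (m ^ n) {{m^n≢0 m n {{>-nonZero 1≤m}}}}

m∣m^n : ∀ m n → 1 ≤ n → m ∣ m ^ n
m∣m^n m (suc n) _ = m∣m*n (m ^ n)

prime∣m^n⇒prime∣m : ∀ {p m} n → Prime p → p ∣ m ^ n → p ∣ m
prime∣m^n⇒prime∣m zero pr p∣1 = contradiction (subst Prime (∣1⇒≡1 p∣1) pr) ¬prime[1]
prime∣m^n⇒prime∣m {m = m} (suc n) pr p∣m*mⁿ =
  [ (λ p∣m → p∣m) , prime∣m^n⇒prime∣m n pr ]′ (euclidsLemma m (m ^ n) pr p∣m*mⁿ)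

∃prime∣ : ∀ {d} → 2 ≤ d → ∃[ p ] Prime p × p ∣ d
∃prime∣ {suc d} 2≤d with factorise (suc d)
... | record { factors = [] ; isFactorisation = d≡1 } = contradiction d≡1 (>⇒≢ 2≤d)
... | record { factors = p ∷ ps ; isFactorisation = d≡p*ps ; factorsPrime = pr ∷ _ } =
  p , pr , subst (p ∣_) (sym d≡p*ps) (m∣m*n (product ps))

prime∤⇒coprime : ∀ {p n} → Prime p → ¬ p ∣ n → Coprime n p
prime∤⇒coprime pr p∤n (i∣n , i∣p) with prime⇒irreducible pr i∣p
... | inj₁ i≡1 = i≡1
... | inj₂ refl = contradiction i∣n p∤n

squareFree-*-prime : ∀ {p m} → SquareFree m → Prime p → ¬ p ∣ m → SquareFree (p * m)
squareFree-*-prime {p} sf pr p∤m d d*d∣p*m with p ∣? d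
... | yes p∣d = contradiction (*-cancelˡ-∣ p {{prime⇒nonZero pr}} (∣-trans (*-pres-∣ p∣d p∣d) d*d∣p*m)) p∤m
... | no p∤d = sf d (coprime-divisor (prime∤⇒coprime pr p∤d*d) d*d∣p*m)
  where
  p∤d*d : ¬ p ∣ d * d
  p∤d*d = [ p∤d , p∤d ]′ ∘ euclidsLemma d d pr

prime∣k⇒prime∣core : ∀ {k kbar p} → IsCore k kbar → 1 ≤ k → Prime p → p ∣ k → p ∣ kbar
prime∣k⇒prime∣core {k} {kbar} {p} (kbar∣k , sf , maximal) 1≤k pr p∣k with p ∣? kbar
... | yes p∣kbar = p∣kbar
... | no p∤kbar = contradiction (maximal (p * kbar) p*kbar∣k (squareFree-*-prime sf pr p∤kbar)) (<⇒≱ kbar<p*kbar)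
  where
  t = quotient kbar∣k
  k≡t*kbar : k ≡ t * kbar
  k≡t*kbar = m∣n⇒n≡quotient*m kbar∣k
  p∣t : p ∣ t
  p∣t = [ (λ p∣t → p∣t) , (λ p∣kbar → contradiction p∣kbar p∤kbar) ]′
          (euclidsLemma t kbar pr (subst (p ∣_) k≡t*kbar p∣k))
  p*kbar∣k : p * kbar ∣ k
  p*kbar∣k = subst (p * kbar ∣_) (sym k≡t*kbar) (*-pres-∣ p∣t ∣-refl)
  kbar≢0 : NonZero kbar
  kbar≢0 = m*n≢0⇒n≢0 t {{subst NonZero k≡t*kbar (>-nonZero 1≤k)}}
  kbar<p*kbar : kbar < p * kbar
  kbar<p*kbar = subst (kbar <_) (*-comm kbar p) (m<m*n kbar p {{kbar≢0}} (nonTrivial⇒n>1 p {{prime⇒nonTrivial pr}}))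

Coprimeₛ : ℕ → ℕ → ℕ → Set
Coprimeₛ s a b = ∀ {d} → 2 ≤ d → d ^ s ∣ a → d ^ s ∣ b → ⊥

module _ (s a b : ℕ) where

  CoprimeₛUpTo : ℕ → Set
  CoprimeₛUpTo N = ∀ {d} → 2 ≤ d → d ≤ N → d ^ s ∣ a → d ^ s ∣ b → ⊥

  CoprimeₛUpTo-pred : ∀ {m} → CoprimeₛUpTo (suc m) → CoprimeₛUpTo m
  CoprimeₛUpTo-pred coprime 2≤d d≤m = coprime 2≤d (m≤n⇒m≤1+n d≤m)

  bestRoot≡1⇒CoprimeₛUpTo : ∀ N → bestRoot s a b N ≡ 1 → CoprimeₛUpTo N
  bestRoot≡1⇒CoprimeₛUpTo zero _ (s≤s _) ()
  bestRoot≡1⇒CoprimeₛUpTo (suc m) eq {d} 2≤d d≤1+m dᵃ dᵇ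
    with suc m ^ s ∣? a | suc m ^ s ∣? b | m≤n⇒m<n∨m≡n d≤1+m
  ... | yes _ | yes _ | _ = <⇒≱ 2≤d (subst (d ≤_) eq d≤1+m)
  ... | yes _ | no _ | inj₁ (s≤s d≤m) = bestRoot≡1⇒CoprimeₛUpTo m eq 2≤d d≤m dᵃ dᵇ
  ... | no _ | _ | inj₁ (s≤s d≤m) = bestRoot≡1⇒CoprimeₛUpTo m eq 2≤d d≤m dᵃ dᵇ
  ... | _ | no ∤b | inj₂ refl = ∤b dᵇ
  ... | no ∤a | _ | inj₂ refl = ∤a dᵃ

  CoprimeₛUpTo⇒bestRoot≡1 : ∀ N → CoprimeₛUpTo N → bestRoot s a b N ≡ 1
  CoprimeₛUpTo⇒bestRoot≡1 zero _ = refl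
  CoprimeₛUpTo⇒bestRoot≡1 (suc m) coprime with suc m ^ s ∣? a | suc m ^ s ∣? b
  ... | no _ | _ = CoprimeₛUpTo⇒bestRoot≡1 m (CoprimeₛUpTo-pred coprime)
  ... | yes _ | no _ = CoprimeₛUpTo⇒bestRoot≡1 m (CoprimeₛUpTo-pred coprime)
  ... | yes dᵃ | yes dᵇ with m
  ...   | zero = refl
  ...   | suc _ = ⊥-elim (coprime (s≤s (s≤s z≤n)) ≤-refl dᵃ dᵇ)

gcdₛ≡1⇔Coprimeₛ : ∀ {s a b} → 1 ≤ s → 1 ≤ b → gcdₛ s a b ≡ 1 ⇔ Coprimeₛ s a b
gcdₛ≡1⇔Coprimeₛ {s} {a} {b} 1≤s 1≤b = mk⇔ to from
  where
  to : gcdₛ s a b ≡ 1 → Coprimeₛ s a b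
  to eq {d} 2≤d dᵃ dᵇ with m^n≡1⇒n≡0∨m≡1 (bestRoot s a b b) s eq
  ... | inj₁ refl = contradiction 1≤s λ ()
  ... | inj₂ root≡1 = bestRoot≡1⇒CoprimeₛUpTo s a b b root≡1 2≤d d≤b dᵃ dᵇ
    where
    d≤b : d ≤ b
    d≤b = ≤-trans (m≤m^n d s (≤-trans (s≤s z≤n) 2≤d) 1≤s) (∣⇒≤ {{>-nonZero 1≤b}} dᵇ)
  from : Coprimeₛ s a b → gcdₛ s a b ≡ 1
  from coprime = trans (cong (_^ s) (CoprimeₛUpTo⇒bestRoot≡1 s a b b (λ 2≤d _ → coprime 2≤d))) (^-zeroˡ s)

does-gcdₛ≡1-cong : ∀ {s a a′ b b′} → 1 ≤ s → 1 ≤ b → 1 ≤ b′ →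
                   Coprimeₛ s a b ⇔ Coprimeₛ s a′ b′ →
                   does (gcdₛ s a b ≟ 1) ≡ does (gcdₛ s a′ b′ ≟ 1)
does-gcdₛ≡1-cong {s} {a} {a′} {b} {b′} 1≤s 1≤b 1≤b′ a,b⇔a′,b′ =
  does-⇔ (⇔-trans (gcdₛ≡1⇔Coprimeₛ 1≤s 1≤b) (⇔-trans a,b⇔a′,b′ (⇔-sym (gcdₛ≡1⇔Coprimeₛ 1≤s 1≤b′))))
         (gcdₛ s a b ≟ 1) (gcdₛ s a′ b′ ≟ 1)

Coprimeₛ-+ˡ : ∀ {s a b} → Coprimeₛ s (b + a) b ⇔ Coprimeₛ s a b
Coprimeₛ-+ˡ {s} {a} {b} = mk⇔ to from
  where
  to : Coprimeₛ s (b + a) b → Coprimeₛ s a b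
  to coprime 2≤d dᵃ dᵇ = coprime 2≤d (∣m∣n⇒∣m+n dᵇ dᵃ) dᵇ
  from : Coprimeₛ s a b → Coprimeₛ s (b + a) b
  from coprime 2≤d dᵇ⁺ᵃ dᵇ = coprime 2≤d (∣m+n∣m⇒∣n dᵇ⁺ᵃ dᵇ) dᵇ

Coprimeₛ-core : ∀ {s h k kbar} → 1 ≤ s → 1 ≤ k → IsCore k kbar →
                Coprimeₛ s h (k ^ s) ⇔ Coprimeₛ s h (kbar ^ s)
Coprimeₛ-core {s} {h} {k} {kbar} 1≤s 1≤k core@(kbar∣k , _) = mk⇔ to from
  where
  to : Coprimeₛ s h (k ^ s) → Coprimeₛ s h (kbar ^ s)
  to coprime 2≤d dʰ dᵏ = coprime 2≤d dʰ (∣-trans dᵏ (^-monoˡ-∣ s kbar∣k))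
  from : Coprimeₛ s h (kbar ^ s) → Coprimeₛ s h (k ^ s)
  from coprime {d} 2≤d dʰ dᵏ with ∃prime∣ 2≤d
  ... | p , pr , p∣d = coprime (nonTrivial⇒n>1 p {{prime⇒nonTrivial pr}}) (∣-trans pˢ∣dˢ dʰ) (^-monoˡ-∣ s p∣kbar)
    where
    pˢ∣dˢ : p ^ s ∣ d ^ s
    pˢ∣dˢ = ^-monoˡ-∣ s p∣d
    p∣kbar : p ∣ kbar
    p∣kbar = prime∣k⇒prime∣core core 1≤k pr
               (prime∣m^n⇒prime∣m s pr (∣-trans (m∣m^n p s 1≤s) (∣-trans pˢ∣dˢ dᵏ)))

frac[m+x,m]≡frac[x,m]+1 : ∀ m x → 1 ≤ m → frac (m + x) m ≡ frac x m +ℚ 1ℚ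
frac[m+x,m]≡frac[x,m]+1 m@(suc b) x _ = toℚᵘ-injective (begin
  toℚᵘ (fromℚᵘ (mkℚᵘ (+ (m + x)) b))              ≈⟨ toℚᵘ-fromℚᵘ (mkℚᵘ (+ (m + x)) b) ⟩
  mkℚᵘ (+ (m + x)) b                               ≈⟨ *≡* numerators ⟩
  mkℚᵘ (+ x) b ℚᵘ.+ ℚᵘ.1ℚᵘ                          ≈⟨ ℚᵘ.+-congˡ ℚᵘ.1ℚᵘ (ℚᵘ.≃-sym (toℚᵘ-fromℚᵘ (mkℚᵘ (+ x) b))) ⟩
  toℚᵘ (frac x m) ℚᵘ.+ toℚᵘ 1ℚ                      ≈⟨ toℚᵘ-homo-+ (frac x m) 1ℚ ⟨
  toℚᵘ (frac x m +ℚ 1ℚ)                             ∎)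
  where
  open ℚᵘ.≃-Reasoning
  numerators : + (m + x) ℤ.* + (m * 1) ≡ (+ x ℤ.* + 1 ℤ.+ + 1 ℤ.* + m) ℤ.* + m
  numerators = trans (cong₂ ℤ._*_ (pos-+ m x) (pos-* m 1)) (ℤ-ring (+ x) (+ m))
    where
    ℤ-ring : ∀ (x m : ℤ) → (m ℤ.+ x) ℤ.* (m ℤ.* ℤ.1ℤ) ≡ (x ℤ.* ℤ.1ℤ ℤ.+ ℤ.1ℤ ℤ.* m) ℤ.* m
    ℤ-ring = ℤ-Solver.solve-∀

frac-*-cancelˡ : ∀ a x m → 1 ≤ a → 1 ≤ m → frac (a * x) (a * m) ≡ frac x m
frac-*-cancelˡ a@(suc a′) x m@(suc b) _ _ =
  fromℚᵘ-cong {mkℚᵘ (+ (a * x)) (b + a′ * m)} {mkℚᵘ (+ x) b} (*≡* (begin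
  + (a * x) ℤ.* + m   ≡⟨ pos-* (a * x) m ⟨
  + (a * x * m)       ≡⟨ cong +_ (rearrange a x m) ⟩
  + (x * (a * m))     ≡⟨ pos-* x (a * m) ⟩
  + x ℤ.* + (a * m)   ∎))
  where
  open ≡-Reasoning
  rearrange : ∀ a x m → a * x * m ≡ x * (a * m)
  rearrange = solve-∀

module _ {c ℓ} (R : CommutativeRing c ℓ) where
  open CommutativeRing R using (Carrier; _≈_; 0#; 1#; setoid; +-cong; +-congˡ; +-congʳ; +-identityˡ; *-identityˡ; zeroˡ; distribʳ)
    renaming (+-assoc to +ᴿ-assoc; _+_ to _+ᴿ_; _*_ to _*ᴿ_; refl to ≈-refl; sym to ≈-sym; trans to ≈-trans; reflexive to ≈-reflexive)
  open import Relation.Binary.Reasoning.Setoid setoid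

  sumUpTo : (ℕ → Carrier) → ℕ → Carrier
  sumUpTo g n = sumR R (applyUpTo g n)

  sumUpTo-cong : ∀ {g g′} n → (∀ i → g i ≈ g′ i) → sumUpTo g n ≈ sumUpTo g′ n
  sumUpTo-cong zero g≈g′ = ≈-refl
  sumUpTo-cong (suc n) g≈g′ = +-cong (g≈g′ 0) (sumUpTo-cong n (g≈g′ ∘ suc))

  sumUpTo-+ : ∀ g m n → sumUpTo g (m + n) ≈ sumUpTo g m +ᴿ sumUpTo (λ i → g (m + i)) n
  sumUpTo-+ g zero n = ≈-sym (+-identityˡ _)
  sumUpTo-+ g (suc m) n = begin
    g 0 +ᴿ sumUpTo (g ∘ suc) (m + n)                                 ≈⟨ +-congˡ (sumUpTo-+ (g ∘ suc) m n) ⟩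
    g 0 +ᴿ (sumUpTo (g ∘ suc) m +ᴿ sumUpTo (λ i → g (suc m + i)) n)  ≈⟨ +ᴿ-assoc _ _ _ ⟨
    g 0 +ᴿ sumUpTo (g ∘ suc) m +ᴿ sumUpTo (λ i → g (suc m + i)) n    ∎

  sumUpTo-periodic : ∀ g m j → (∀ i → g (m + i) ≈ g i) → sumUpTo g (j * m) ≈ natR R j *ᴿ sumUpTo g m
  sumUpTo-periodic g m zero periodic = ≈-sym (zeroˡ _)
  sumUpTo-periodic g m (suc j) periodic = begin
    sumUpTo g (m + j * m)                                   ≈⟨ sumUpTo-+ g m (j * m) ⟩
    sumUpTo g m +ᴿ sumUpTo (λ i → g (m + i)) (j * m)        ≈⟨ +-congˡ (sumUpTo-cong (j * m) periodic) ⟩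
    sumUpTo g m +ᴿ sumUpTo g (j * m)                        ≈⟨ +-congˡ (sumUpTo-periodic g m j periodic) ⟩
    sumUpTo g m +ᴿ natR R j *ᴿ sumUpTo g m                  ≈⟨ +-congʳ (*-identityˡ _) ⟨
    1# *ᴿ sumUpTo g m +ᴿ natR R j *ᴿ sumUpTo g m            ≈⟨ distribʳ _ _ _ ⟨
    (1# +ᴿ natR R j) *ᴿ sumUpTo g m                         ∎

  if-cong : ∀ {b b′ : Bool} {x y} → b ≡ b′ → x ≈ y → (if b then x else 0#) ≈ (if b′ then y else 0#)
  if-cong {true} refl x≈y = x≈y
  if-cong {false} refl _ = ≈-refl

  module _ (e : ℚ → Carrier) (s : ℕ) where

    ramanujanTerm : ℕ → ℕ → ℕ → Carrier
    ramanujanTerm K n h = if does (gcdₛ s h K ≟ 1) then e (frac (n * h) K) else 0#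

    ramanujanSum : ℕ → ℕ → Carrier
    ramanujanSum K n = sumUpTo (ramanujanTerm K n ∘ suc) K

    cohenRamanujan≡ramanujanSum : ∀ k n → cohenRamanujan R e s k n ≡ ramanujanSum (k ^ s) n
    cohenRamanujan≡ramanujanSum k n = cong (sumR R) (map-upTo (ramanujanTerm (k ^ s) n ∘ suc) (k ^ s))

    ramanujanTerm-inflate : ∀ A B n h → 1 ≤ A → 1 ≤ B →
                            does (gcdₛ s h (A * B) ≟ 1) ≡ does (gcdₛ s h B ≟ 1) →
                            ramanujanTerm (A * B) (n * A) h ≈ ramanujanTerm B n h
    ramanujanTerm-inflate A B n h 1≤A 1≤B same-condition = if-cong same-condition (begin
      e (frac (n * A * h) (A * B))      ≡⟨ cong (λ y → e (frac y (A * B))) (rearrange n A h) ⟩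
      e (frac (A * (n * h)) (A * B))    ≡⟨ cong e (frac-*-cancelˡ A (n * h) B 1≤A 1≤B) ⟩
      e (frac (n * h) B)                ∎)
      where
      rearrange : ∀ n a h → n * a * h ≡ a * (n * h)
      rearrange = solve-∀

    module _ (e-periodic : ∀ q → e (q +ℚ 1ℚ) ≈ e q) where

      e-frac-periodic : ∀ j m x → 1 ≤ m → e (frac (j * m + x) m) ≈ e (frac x m)
      e-frac-periodic zero m x _ = ≈-refl
      e-frac-periodic (suc j) m x 1≤m = begin
        e (frac (m + j * m + x) m)     ≡⟨ cong (λ y → e (frac y m)) (+-assoc m (j * m) x) ⟩
        e (frac (m + (j * m + x)) m)   ≡⟨ cong e (frac[m+x,m]≡frac[x,m]+1 m (j * m + x) 1≤m) ⟩
        e (frac (j * m + x) m +ℚ 1ℚ)   ≈⟨ e-periodic _ ⟩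
        e (frac (j * m + x) m)         ≈⟨ e-frac-periodic j m x 1≤m ⟩
        e (frac x m)                   ∎

      ramanujanTerm-periodic : ∀ K n h → 1 ≤ s → 1 ≤ K → ramanujanTerm K n (K + h) ≈ ramanujanTerm K n h
      ramanujanTerm-periodic K n h 1≤s 1≤K = if-cong (does-gcdₛ≡1-cong 1≤s 1≤K 1≤K (Coprimeₛ-+ˡ {s})) (begin
        e (frac (n * (K + h)) K)       ≡⟨ cong (λ y → e (frac y K)) (*-distribˡ-+ n K h) ⟩
        e (frac (n * K + n * h) K)     ≈⟨ e-frac-periodic n K (n * h) 1≤K ⟩
        e (frac (n * h) K)             ∎)

      ramanujanSum-inflate : ∀ A B n → 1 ≤ s → 1 ≤ A → 1 ≤ B →
                             (∀ h → Coprimeₛ s h (A * B) ⇔ Coprimeₛ s h B) →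
                             ramanujanSum (A * B) (n * A) ≈ natR R A *ᴿ ramanujanSum B n
      ramanujanSum-inflate A B n 1≤s 1≤A 1≤B same-coprimality = begin
        sumUpTo (ramanujanTerm (A * B) (n * A) ∘ suc) (A * B)  ≈⟨ sumUpTo-cong (A * B) inflate ⟩
        sumUpTo (ramanujanTerm B n ∘ suc) (A * B)              ≈⟨ sumUpTo-periodic (ramanujanTerm B n ∘ suc) B A periodic ⟩
        natR R A *ᴿ ramanujanSum B n                           ∎
        where
        inflate : ∀ i → ramanujanTerm (A * B) (n * A) (suc i) ≈ ramanujanTerm B n (suc i)
        inflate i = ramanujanTerm-inflate A B n (suc i) 1≤A 1≤B
                      (does-gcdₛ≡1-cong 1≤s (*-mono-≤ 1≤A 1≤B) 1≤B (same-coprimality (suc i)))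
        periodic : ∀ i → ramanujanTerm B n (suc (B + i)) ≈ ramanujanTerm B n (suc i)
        periodic i = ≈-trans (≈-reflexive (cong (ramanujanTerm B n) (sym (+-suc B i))))
                             (ramanujanTerm-periodic B n (suc i) 1≤s 1≤B)

lemma3p4 : ∀ {c ℓ} (R : CommutativeRing c ℓ) (e : ℚ → CommutativeRing.Carrier R)
    → (∀ q → CommutativeRing._≈_ R (e (q +ℚ 1ℚ)) (e q))
    → (s : ℕ) → 1 ≤ s → (k n : ℕ) → 1 ≤ k → 1 ≤ n
    → (kbar kstar : ℕ) → IsCore k kbar → kstar * kbar ≡ k
    → CommutativeRing._≈_ R (cohenRamanujan R e s k (n * kstar ^ s))
        (CommutativeRing._*_ R (natR R (kstar ^ s)) (cohenRamanujan R e s kbar n))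
lemma3p4 R e e-periodic s 1≤s _ n 1≤k _ kbar kstar core refl = begin
  cohenRamanujan R e s (kstar * kbar) (n * kstar ^ s)
    ≡⟨ cohenRamanujan≡ramanujanSum R e s (kstar * kbar) (n * kstar ^ s) ⟩
  ramanujanSum R e s ((kstar * kbar) ^ s) (n * kstar ^ s)
    ≡⟨ cong (λ K → ramanujanSum R e s K (n * kstar ^ s)) (^-distribʳ-* kstar kbar s) ⟩
  ramanujanSum R e s (kstar ^ s * kbar ^ s) (n * kstar ^ s)
    ≈⟨ ramanujanSum-inflate R e s e-periodic (kstar ^ s) (kbar ^ s) n
         1≤s (m^n>0 kstar s) (m^n>0 kbar s) same-coprimality ⟩
  natR R (kstar ^ s) *ᴿ ramanujanSum R e s (kbar ^ s) n
    ≡⟨ cong (natR R (kstar ^ s) *ᴿ_) (cohenRamanujan≡ramanujanSum R e s kbar n) ⟨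
  natR R (kstar ^ s) *ᴿ cohenRamanujan R e s kbar n
    ∎
  where
  open CommutativeRing R using (setoid) renaming (_*_ to _*ᴿ_)
  open import Relation.Binary.Reasoning.Setoid setoid
  instance
    kstar*kbar≢0 : NonZero (kstar * kbar)
    kstar*kbar≢0 = >-nonZero 1≤k
    kstar≢0 : NonZero kstar
    kstar≢0 = m*n≢0⇒m≢0 kstar
    kbar≢0 : NonZero kbar
    kbar≢0 = m*n≢0⇒n≢0 kstar
  same-coprimality : ∀ h → Coprimeₛ s h (kstar ^ s * kbar ^ s) ⇔ Coprimeₛ s h (kbar ^ s)
  same-coprimality h = subst (λ K → Coprimeₛ s h K ⇔ Coprimeₛ s h (kbar ^ s))
                             (^-distribʳ-* kstar kbar s) (Coprimeₛ-core 1≤s 1≤k core)
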